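{- Let $n\ge3$ be odd, $\Gamma=\mathbb{Z}/n\mathbb{Z}$ with generator $\gamma$, and let $(G,\phi)$ be a $C_n$-tight graph containing a vertex $v$ incident to exactly two elements of $E\cup L$ (either exactly two edges and no loop, or exactly one edge and exactly one loop). Then the graph obtained from $G$ by deleting the vertices $v,\gamma v,\dots,\gamma^{n-1}v$ together with all their incident edges and loops, with the induced $\Gamma$-action, is $C_n$-tight.
   Context: A looped simple graph $G=(V,E,L)$: finite vertex set, edges unordered pairs of distinct vertices (no multiple edges), loops each incident to one vertex (possibly several per vertex). $G$ is sparse if $|E'|+|L'|\le2|V'|$ for every subgraph $(V',E',L')$ and $|E'|\le2|V'|-3$ for every loopless subgraph with $E'\ne\emptyset$; tight if sparse and $|E|+|L|=2|V|$. $(G,\phi)$ is $\Gamma$-symmetric if $\phi:\Gamma\to\mathrm{Aut}(G)$ is a homomorphism (automorphisms = permutations of $V$ and of $L$ preserving adjacency and vertex–loop incidence); $\gamma v$ denotes the image. An element fixes a vertex/loop if it maps it to itself, and an edge if it fixes or swaps its endpoints. For odd $n$, $(G,\phi)$ is $C_n$-tight if $G$ is tight and no non-identity element of $\Gamma$ fixes a vertex, edge or loop of $G$. -}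

module Defs where

open import Data.Nat using (ℕ; zero; suc; _+_; _*_; _≤_; _<_)
open import Data.Bool using (Bool; true; false; _∧_; _∨_; not)
open import Data.Fin using (Fin; _≟_)
open import Data.Fin.Subset using (Subset; _∈_; _⊆_; ∣_∣)
open import Data.Fin.Subset.Properties using (_∈?_)
open import Data.Fin.Permutation using (Permutation′; _⟨$⟩ʳ_)
open import Data.Vec using (tabulate)
open import Data.Product using (_×_; _,_; proj₁; proj₂; ∃)
open import Data.Sum using (_⊎_)
open import Relation.Nullary using (¬_)
open import Relation.Nullary.Decidable using (⌊_⌋)
open import Relation.Binary.PropositionalEquality using (_≡_; _≢_)
open import Function.Bundles using (_⇔_)

-- Vertices, edges and loops are the elements of subsets V, E, L of the
-- ambient finite sets Fin N, Fin M, Fin K.  Edge e has endpoints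
-- ends e, loop l is incident to the vertex loopAt l.  (Every finite
-- looped simple graph arises this way up to isomorphism; the subset
-- presentation makes "deleting vertices" and subgraphs easy to state.)

record LGraph : Set where
  field
    N M K  : ℕ
    ends   : Fin M → Fin N × Fin N
    loopAt : Fin K → Fin N
    V      : Subset N
    E      : Subset M
    L      : Subset K
open LGraph public

SamePair : ∀ {N} → Fin N × Fin N → Fin N × Fin N → Set
SamePair (a , b) (c , d) = (a ≡ c × b ≡ d) ⊎ (a ≡ d × b ≡ c)

record WellFormed (G : LGraph) : Set where
  field
    ends-in   : ∀ e → e ∈ E G → proj₁ (ends G e) ∈ V G × proj₂ (ends G e) ∈ V G
    ends-dist : ∀ e → e ∈ E G → proj₁ (ends G e) ≢ proj₂ (ends G e)
    simple    : ∀ e f → e ∈ E G → f ∈ E G → SamePair (ends G e) (ends G f) → e ≡ f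
    loop-in   : ∀ l → l ∈ L G → loopAt G l ∈ V G

record Subgraph (G : LGraph) : Set where
  field
    V' : Subset (N G)
    E' : Subset (M G)
    L' : Subset (K G)
    V'⊆V : V' ⊆ V G
    E'⊆E : E' ⊆ E G
    L'⊆L : L' ⊆ L G
    E'-ends : ∀ e → e ∈ E' → proj₁ (ends G e) ∈ V' × proj₂ (ends G e) ∈ V'
    L'-at   : ∀ l → l ∈ L' → loopAt G l ∈ V'
open Subgraph public

Sparse : LGraph → Set
Sparse G = ∀ (H : Subgraph G) →
    (∣ E' H ∣ + ∣ L' H ∣ ≤ 2 * ∣ V' H ∣)
  × (∣ L' H ∣ ≡ 0 → 1 ≤ ∣ E' H ∣ → ∣ E' H ∣ + 3 ≤ 2 * ∣ V' H ∣)

Tight : LGraph → Set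
Tight G = WellFormed G × Sparse G × (∣ E G ∣ + ∣ L G ∣ ≡ 2 * ∣ V G ∣)

Adj : (G : LGraph) → Fin (N G) → Fin (N G) → Set
Adj G u w = ∃ λ e → e ∈ E G × SamePair (ends G e) (u , w)

record IsAut (G : LGraph) (σV : Permutation′ (N G)) (σL : Permutation′ (K G)) : Set where
  field
    pres-V   : ∀ v → (v ∈ V G) ⇔ (σV ⟨$⟩ʳ v ∈ V G)
    pres-L   : ∀ l → (l ∈ L G) ⇔ (σL ⟨$⟩ʳ l ∈ L G)
    pres-adj : ∀ u w → u ∈ V G → w ∈ V G → Adj G u w ⇔ Adj G (σV ⟨$⟩ʳ u) (σV ⟨$⟩ʳ w)
    pres-inc : ∀ l → l ∈ L G → loopAt G (σL ⟨$⟩ʳ l) ≡ σV ⟨$⟩ʳ (loopAt G l)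

iter : ∀ {A : Set} → (A → A) → ℕ → A → A
iter f zero    x = x
iter f (suc k) x = f (iter f k x)

-- (G, φ) is C_n-symmetric, where φ sends the generator γ of Z/nZ to the
-- automorphism (σV, σL), hence γ^k to (σV^k, σL^k); φ is a well-defined
-- homomorphism iff γ^n acts as the identity on G.
record CnSymmetric (n : ℕ) (G : LGraph) (σV : Permutation′ (N G)) (σL : Permutation′ (K G)) : Set where
  field
    aut    : IsAut G σV σL
    orderV : ∀ v → v ∈ V G → iter (σV ⟨$⟩ʳ_) n v ≡ v
    orderL : ∀ l → l ∈ L G → iter (σL ⟨$⟩ʳ_) n l ≡ l

record FreeAction (n : ℕ) (G : LGraph) (σV : Permutation′ (N G)) (σL : Permutation′ (K G)) : Set where
  field
    freeV : ∀ k → 0 < k → k < n → ∀ v → v ∈ V G → iter (σV ⟨$⟩ʳ_) k v ≢ v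
    freeE : ∀ k → 0 < k → k < n → ∀ e → e ∈ E G →
      ¬ SamePair (iter (σV ⟨$⟩ʳ_) k (proj₁ (ends G e)) , iter (σV ⟨$⟩ʳ_) k (proj₂ (ends G e))) (ends G e)
    freeL : ∀ k → 0 < k → k < n → ∀ l → l ∈ L G → iter (σL ⟨$⟩ʳ_) k l ≢ l

CnTight : (n : ℕ) (G : LGraph) (σV : Permutation′ (N G)) (σL : Permutation′ (K G)) → Set
CnTight n G σV σL = Tight G × CnSymmetric n G σV σL × FreeAction n G σV σL

incEdges : (G : LGraph) → Fin (N G) → Subset (M G)
incEdges G v = tabulate λ e →
  ⌊ e ∈? E G ⌋ ∧ (⌊ proj₁ (ends G e) ≟ v ⌋ ∨ ⌊ proj₂ (ends G e) ≟ v ⌋)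

incLoops : (G : LGraph) → Fin (N G) → Subset (K G)
incLoops G v = tabulate λ l → ⌊ l ∈? L G ⌋ ∧ ⌊ loopAt G l ≟ v ⌋

inOrbit : ∀ {A : Set} → (A → A) → ℕ → (A → A → Bool) → A → A → Bool
inOrbit f zero    eq v u = false
inOrbit f (suc k) eq v u = eq (iter f k v) u ∨ inOrbit f k eq v u

deleteOrbit : (n : ℕ) (G : LGraph) (σV : Permutation′ (N G)) → Fin (N G) → LGraph
deleteOrbit n G σV v = record
  { N = N G ; M = M G ; K = K G ; ends = ends G ; loopAt = loopAt G
  ; V = tabulate λ u → ⌊ u ∈? V G ⌋ ∧ not (orb u)
  ; E = tabulate λ e → ⌊ e ∈? E G ⌋ ∧ not (orb (proj₁ (ends G e))) ∧ not (orb (proj₂ (ends G e)))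
  ; L = tabulate λ l → ⌊ l ∈? L G ⌋ ∧ not (orb (loopAt G l))
  }
  where
  orb : Fin (N G) → Bool
  orb = inOrbit (σV ⟨$⟩ʳ_) n (λ a b → ⌊ a ≟ b ⌋) v

-- Deleting the orbit of v leaves a subgraph that is invariant under σ, so well-formedness,
-- sparsity, the C_n-symmetry and the freeness of the action are inherited, and only
-- |E′| + |L′| ≥ 2|V′| remains.  An automorphism cannot decrease degrees and σⁿ v = v, so
-- every vertex of the orbit has degree at most deg v = 2, while freeness makes the n orbit
-- vertices distinct.  Deleting the orbit therefore removes n vertices but at most 2n edges
-- and loops:  2|V′| + 2n ≤ 2|V| = |E| + |L| ≤ |E′| + |L′| + 2n.

module Submission where

open import Defs
open import Data.Nat using (ℕ; zero; suc; _+_; _*_; _∸_; _≤_; _<_; _%_; z≤n; s≤s)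
open import Data.Nat.Properties hiding (suc-injective; 0≢1+n; _≟_)
open import Data.Bool using (Bool; true; false; T; T?; not; _∧_)
open import Data.Bool.Properties using (T-∧; T-∨; T-≡)
open import Data.Unit using (tt)
open import Data.Fin using (Fin; suc; _≟_)
open import Data.Fin.Properties using (suc-injective; 0≢1+n)
open import Data.Fin.Subset using (Subset; _∈_; _∉_; _⊆_; _∪_; _-_; ⊥; ∣_∣)
open import Data.Fin.Subset.Properties using (_∈?_; x∈p∪q⁺; x∈p∧x≢y⇒x∈p-y; x∈p⇒∣p-x∣<∣p∣; p⊆q⇒∣p∣≤∣q∣; ∣⊥∣≡0)
open import Data.Fin.Permutation using (Permutation′; _⟨$⟩ʳ_)
open import Data.Vec using ([]; _∷_; tabulate)
open import Data.Vec.Base using (here; there)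
open import Data.Vec.Properties using (lookup∘tabulate; []=⇒lookup; lookup⇒[]=)
open import Data.Product using (_×_; _,_; proj₁; proj₂; ∃; ∃-syntax)
open import Data.Product.Function.NonDependent.Propositional using (_×-⇔_)
open import Data.Sum using (_⊎_; inj₁; inj₂)
import Data.Sum as Sum
open import Data.Sum.Function.Propositional using (_⊎-⇔_)
open import Function using (_∘_)
open import Function.Bundles using (_⇔_; mk⇔; Equivalence; Injection)
open import Function.Construct.Composition using (_⇔-∘_)
open import Function.Construct.Symmetry using (⇔-sym)
open import Function.Definitions using (Injective)
open import Function.Properties.Inverse using (↔⇒↣)
open import Function.Related.TypeIsomorphisms using (¬-cong-⇔)
open import Relation.Nullary using (¬_; Dec; yes; no)
open import Relation.Nullary.Decidable using (⌊_⌋; toWitness; fromWitness)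
open import Relation.Binary.Definitions using (DecidableEquality)
open import Relation.Binary.PropositionalEquality
open import Algebra.Properties.CommutativeSemigroup +-commutativeSemigroup using (interchange)

∣p∪q∣≤∣p∣+∣q∣ : ∀ {m} (p q : Subset m) → ∣ p ∪ q ∣ ≤ ∣ p ∣ + ∣ q ∣
∣p∪q∣≤∣p∣+∣q∣ []          []          = z≤n
∣p∪q∣≤∣p∣+∣q∣ (true  ∷ p) (true  ∷ q) = s≤s (≤-trans (∣p∪q∣≤∣p∣+∣q∣ p q) (+-monoʳ-≤ ∣ p ∣ (n≤1+n ∣ q ∣)))
∣p∪q∣≤∣p∣+∣q∣ (true  ∷ p) (false ∷ q) = s≤s (∣p∪q∣≤∣p∣+∣q∣ p q)
∣p∪q∣≤∣p∣+∣q∣ (false ∷ p) (true  ∷ q) = ≤-trans (s≤s (∣p∪q∣≤∣p∣+∣q∣ p q)) (≤-reflexive (sym (+-suc ∣ p ∣ ∣ q ∣)))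
∣p∪q∣≤∣p∣+∣q∣ (false ∷ p) (false ∷ q) = ∣p∪q∣≤∣p∣+∣q∣ p q

∣p∣≤∣q∣-injective : ∀ {m m′} {p : Subset m} {q : Subset m′} (R : Fin m → Fin m′ → Set) →
  (∀ {x} → x ∈ p → ∃ λ y → y ∈ q × R x y) →
  (∀ {x x′ y} → x ∈ p → x′ ∈ p → R x y → R x′ y → x ≡ x′) →
  ∣ p ∣ ≤ ∣ q ∣
∣p∣≤∣q∣-injective {p = []}        R image inj = z≤n
∣p∣≤∣q∣-injective {p = false ∷ p} R image inj =
  ∣p∣≤∣q∣-injective {p = p} (λ x → R (suc x)) (λ x∈p → image (there x∈p))
    (λ x∈p x′∈p r r′ → suc-injective (inj (there x∈p) (there x′∈p) r r′))
∣p∣≤∣q∣-injective {p = true ∷ p} {q} R image inj with image here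
... | y₀ , y₀∈q , r₀ = ≤-trans (s≤s rest) (x∈p⇒∣p-x∣<∣p∣ y₀∈q)
  where
  image′ : ∀ {x} → x ∈ p → ∃ λ y → y ∈ q - y₀ × R (suc x) y
  image′ x∈p with image (there x∈p)
  ... | y , y∈q , r = y , x∈p∧x≢y⇒x∈p-y y∈q (λ { refl → 0≢1+n (inj here (there x∈p) r₀ r) }) , r
  rest : ∣ p ∣ ≤ ∣ q - y₀ ∣
  rest = ∣p∣≤∣q∣-injective {p = p} (λ x → R (suc x)) image′
    (λ x∈p x′∈p r r′ → suc-injective (inj (there x∈p) (there x′∈p) r r′))

∣p∣+k≤∣q∣ : ∀ {m} {p q : Subset m} (x : ℕ → Fin m) k → p ⊆ q →
  (∀ {j} → j < k → x j ∈ q) → (∀ {j} → j < k → x j ∉ p) →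
  (∀ {i j} → i < j → j < k → x i ≢ x j) →
  ∣ p ∣ + k ≤ ∣ q ∣
∣p∣+k≤∣q∣ {p = p} x zero    p⊆q _ _ _ = ≤-trans (≤-reflexive (+-identityʳ ∣ p ∣)) (p⊆q⇒∣p∣≤∣q∣ p⊆q)
∣p∣+k≤∣q∣ {p = p} {q} x (suc k) p⊆q x∈q x∉p distinct = begin
  ∣ p ∣ + suc k       ≡⟨ +-suc ∣ p ∣ k ⟩
  suc (∣ p ∣ + k)     ≤⟨ s≤s (∣p∣+k≤∣q∣ x k p⊆q′ x∈q′ (λ j<k → x∉p (m<n⇒m<1+n j<k)) (λ i<j j<k → distinct i<j (m<n⇒m<1+n j<k))) ⟩
  suc ∣ q - x k ∣     ≤⟨ x∈p⇒∣p-x∣<∣p∣ (x∈q ≤-refl) ⟩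
  ∣ q ∣               ∎
  where
  open ≤-Reasoning
  p⊆q′ : p ⊆ q - x k
  p⊆q′ y∈p = x∈p∧x≢y⇒x∈p-y (p⊆q y∈p) (λ { refl → x∉p ≤-refl y∈p })
  x∈q′ : ∀ {j} → j < k → x j ∈ q - x k
  x∈q′ j<k = x∈p∧x≢y⇒x∈p-y (x∈q (m<n⇒m<1+n j<k)) (distinct j<k ≤-refl)

⋃< : ∀ {m} → ℕ → (ℕ → Subset m) → Subset m
⋃< zero    f = ⊥
⋃< (suc k) f = f k ∪ ⋃< k f

∈⋃< : ∀ {m} {f : ℕ → Subset m} {x j k} → j < k → x ∈ f j → x ∈ ⋃< k f
∈⋃< {f = f} {k = suc k} j<1+k x∈fj with m<1+n⇒m<n∨m≡n j<1+k
... | inj₁ j<k  = x∈p∪q⁺ (inj₂ (∈⋃< j<k x∈fj))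
... | inj₂ refl = x∈p∪q⁺ (inj₁ x∈fj)

∣⋃<∣+∣⋃<∣≤ : ∀ {m m′} k (f : ℕ → Subset m) (g : ℕ → Subset m′) c →
  (∀ {j} → j < k → ∣ f j ∣ + ∣ g j ∣ ≤ c) → ∣ ⋃< k f ∣ + ∣ ⋃< k g ∣ ≤ k * c
∣⋃<∣+∣⋃<∣≤ {m} {m′} zero f g c _ = ≤-reflexive (cong₂ _+_ (∣⊥∣≡0 m) (∣⊥∣≡0 m′))
∣⋃<∣+∣⋃<∣≤ {m} {m′} (suc k) f g c bound = begin
  ∣ f k ∪ F ∣ + ∣ g k ∪ G ∣                 ≤⟨ +-mono-≤ (∣p∪q∣≤∣p∣+∣q∣ (f k) F) (∣p∪q∣≤∣p∣+∣q∣ (g k) G) ⟩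
  (∣ f k ∣ + ∣ F ∣) + (∣ g k ∣ + ∣ G ∣)     ≡⟨ interchange (∣ f k ∣) (∣ F ∣) (∣ g k ∣) (∣ G ∣) ⟩
  (∣ f k ∣ + ∣ g k ∣) + (∣ F ∣ + ∣ G ∣)     ≤⟨ +-mono-≤ (bound ≤-refl) (∣⋃<∣+∣⋃<∣≤ k f g c (λ j<k → bound (m<n⇒m<1+n j<k))) ⟩
  c + k * c                                 ∎
  where
  open ≤-Reasoning
  F : Subset m
  F = ⋃< k f
  G : Subset m′
  G = ⋃< k g

module _ {A : Set} (f : A → A) where

  iter-+ : ∀ i j x → iter f (i + j) x ≡ iter f i (iter f j x)
  iter-+ zero    j x = refl
  iter-+ (suc i) j x = cong f (iter-+ i j x)

  InOrbit : ℕ → A → A → Set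
  InOrbit k x y = ∃[ j ] j < k × iter f j x ≡ y

  T-inOrbit : (_≟_ : DecidableEquality A) → ∀ k x y →
    T (inOrbit f k (λ a b → ⌊ a ≟ b ⌋) x y) ⇔ InOrbit k x y
  T-inOrbit _≟_ zero    x y = mk⇔ (λ ()) (λ ())
  T-inOrbit _≟_ (suc k) x y = mk⇔ to from
    where
    Found : Set
    Found = T (inOrbit f (suc k) (λ a b → ⌊ a ≟ b ⌋) x y)
    to : Found → InOrbit (suc k) x y
    to t with Equivalence.to T-∨ t
    ... | inj₁ at-k   = k , ≤-refl , toWitness {a? = iter f k x ≟ y} at-k
    ... | inj₂ below-k with Equivalence.to (T-inOrbit _≟_ k x y) below-k
    ...   | j , j<k , eq = j , m<n⇒m<1+n j<k , eq
    from : InOrbit (suc k) x y → Found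
    from (j , j<1+k , eq) with m<1+n⇒m<n∨m≡n j<1+k
    ... | inj₁ j<k  = Equivalence.from T-∨ (inj₂ (Equivalence.from (T-inOrbit _≟_ k x y) (j , j<k , eq)))
    ... | inj₂ refl = Equivalence.from T-∨ (inj₁ (fromWitness {a? = iter f k x ≟ y} eq))

  InOrbit-step : Injective _≡_ _≡_ f → ∀ {n x} → iter f n x ≡ x →
    ∀ y → InOrbit n x (f y) ⇔ InOrbit n x y
  InOrbit-step f-inj {suc n} {x} period y = mk⇔ to from
    where
    to : InOrbit (suc n) x (f y) → InOrbit (suc n) x y
    to (zero  , _     , eq) = n , ≤-refl , f-inj (trans period eq)
    to (suc j , j<1+n , eq) = j , m<n⇒m<1+n (≤-pred j<1+n) , f-inj eq
    from : InOrbit (suc n) x y → InOrbit (suc n) x (f y)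
    from (j , j<1+n , eq) with m<1+n⇒m<n∨m≡n j<1+n
    ... | inj₁ j<n  = suc j , s≤s j<n , cong f eq
    ... | inj₂ refl = zero , s≤s z≤n , trans (sym period) (cong f eq)
  InOrbit-step f-inj {zero} _ y = mk⇔ (λ ()) (λ ())

  iter-cycle-≤ : (h : A → ℕ) → (∀ y → h y ≤ h (f y)) → ∀ {n x} → iter f n x ≡ x →
    ∀ {j} → j ≤ n → h (iter f j x) ≤ h x
  iter-cycle-≤ h mono {n} {x} period {j} j≤n = begin
    h (iter f j x)             ≤⟨ ascend (n ∸ j) ⟩
    h (iter f (n ∸ j + j) x)   ≡⟨ cong (λ k → h (iter f k x)) (m∸n+n≡m j≤n) ⟩
    h (iter f n x)             ≡⟨ cong h period ⟩
    h x                        ∎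
    where
    open ≤-Reasoning
    ascend : ∀ d → h (iter f j x) ≤ h (iter f (d + j) x)
    ascend zero    = ≤-refl
    ascend (suc d) = ≤-trans (ascend d) (mono (iter f (d + j) x))

∈-tabulate : ∀ {m} {f : Fin m → Bool} {x} → x ∈ tabulate f ⇔ T (f x)
∈-tabulate {f = f} {x} = mk⇔
  (λ x∈ → Equivalence.from T-≡ (trans (sym (lookup∘tabulate f x)) ([]=⇒lookup x∈)))
  (λ t → lookup⇒[]= x (tabulate f) (trans (lookup∘tabulate f x) (Equivalence.to T-≡ t)))

T-⌊⌋ : ∀ {P : Set} (P? : Dec P) → T ⌊ P? ⌋ ⇔ P
T-⌊⌋ P? = mk⇔ toWitness fromWitness

T-not : ∀ {b} → T (not b) ⇔ (¬ T b)
T-not {false} = mk⇔ (λ _ ()) (λ _ → tt)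
T-not {true}  = mk⇔ (λ ()) (λ ¬t → ¬t tt)

module _ (G : LGraph) where

  ∈-incEdges : ∀ {u e} → e ∈ incEdges G u ⇔ (e ∈ E G × (proj₁ (ends G e) ≡ u ⊎ proj₂ (ends G e) ≡ u))
  ∈-incEdges {u} {e} = (T-⌊⌋ (e ∈? E G) ×-⇔ ((T-⌊⌋ (_ ≟ u) ⊎-⇔ T-⌊⌋ (_ ≟ u)) ⇔-∘ T-∨)) ⇔-∘ (T-∧ ⇔-∘ ∈-tabulate)

  ∈-incLoops : ∀ {u l} → l ∈ incLoops G u ⇔ (l ∈ L G × loopAt G l ≡ u)
  ∈-incLoops {u} {l} = (T-⌊⌋ (l ∈? L G) ×-⇔ T-⌊⌋ (loopAt G l ≟ u)) ⇔-∘ (T-∧ ⇔-∘ ∈-tabulate)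

wholeSubgraph : ∀ {G} → WellFormed G → Subgraph G
wholeSubgraph {G} wf = record
  { V' = V G ; E' = E G ; L' = L G ; V'⊆V = λ x → x ; E'⊆E = λ x → x ; L'⊆L = λ x → x
  ; E'-ends = WellFormed.ends-in wf ; L'-at = WellFormed.loop-in wf }

∣E∣+∣L∣≤2∣V∣ : ∀ {G} → WellFormed G → Sparse G → ∣ E G ∣ + ∣ L G ∣ ≤ 2 * ∣ V G ∣
∣E∣+∣L∣≤2∣V∣ wf sparse = proj₁ (sparse (wholeSubgraph wf))

deleteVertices : (G : LGraph) → (Fin (N G) → Bool) → LGraph
deleteVertices G del = record
  { N = N G ; M = M G ; K = K G ; ends = ends G ; loopAt = loopAt G
  ; V = tabulate λ u → ⌊ u ∈? V G ⌋ ∧ not (del u)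
  ; E = tabulate λ e → ⌊ e ∈? E G ⌋ ∧ not (del (proj₁ (ends G e))) ∧ not (del (proj₂ (ends G e)))
  ; L = tabulate λ l → ⌊ l ∈? L G ⌋ ∧ not (del (loopAt G l))
  }

module _ (G : LGraph) (del : Fin (N G) → Bool) where

  private
    G′ : LGraph
    G′ = deleteVertices G del

  ∈V-deleteVertices : ∀ {u} → u ∈ V G′ ⇔ (u ∈ V G × ¬ T (del u))
  ∈V-deleteVertices {u} = (T-⌊⌋ (u ∈? V G) ×-⇔ T-not) ⇔-∘ (T-∧ ⇔-∘ ∈-tabulate)

  ∈E-deleteVertices : ∀ {e} → e ∈ E G′ ⇔
    (e ∈ E G × ¬ T (del (proj₁ (ends G e))) × ¬ T (del (proj₂ (ends G e))))
  ∈E-deleteVertices {e} = (T-⌊⌋ (e ∈? E G) ×-⇔ ((T-not ×-⇔ T-not) ⇔-∘ T-∧)) ⇔-∘ (T-∧ ⇔-∘ ∈-tabulate)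

  ∈L-deleteVertices : ∀ {l} → l ∈ L G′ ⇔ (l ∈ L G × ¬ T (del (loopAt G l)))
  ∈L-deleteVertices {l} = (T-⌊⌋ (l ∈? L G) ×-⇔ T-not) ⇔-∘ (T-∧ ⇔-∘ ∈-tabulate)

  private
    ⊆V : V G′ ⊆ V G
    ⊆V = proj₁ ∘ Equivalence.to ∈V-deleteVertices
    ⊆E : E G′ ⊆ E G
    ⊆E = proj₁ ∘ Equivalence.to ∈E-deleteVertices
    ⊆L : L G′ ⊆ L G
    ⊆L = proj₁ ∘ Equivalence.to ∈L-deleteVertices

  WellFormed-deleteVertices : WellFormed G → WellFormed G′
  WellFormed-deleteVertices wf = record
    { ends-in   = λ e e∈ → let (e∈E , ¬del₁ , ¬del₂) = Equivalence.to ∈E-deleteVertices e∈ in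
        Equivalence.from ∈V-deleteVertices (proj₁ (ends-in e e∈E) , ¬del₁) ,
        Equivalence.from ∈V-deleteVertices (proj₂ (ends-in e e∈E) , ¬del₂)
    ; ends-dist = λ e e∈ → ends-dist e (⊆E e∈)
    ; simple    = λ e f e∈ f∈ → simple e f (⊆E e∈) (⊆E f∈)
    ; loop-in   = λ l l∈ → let (l∈L , ¬del) = Equivalence.to ∈L-deleteVertices l∈ in
        Equivalence.from ∈V-deleteVertices (loop-in l l∈L , ¬del)
    }
    where open WellFormed wf

  Sparse-deleteVertices : Sparse G → Sparse G′
  Sparse-deleteVertices sparse H = sparse record
    { V' = V' H ; E' = E' H ; L' = L' H
    ; V'⊆V = ⊆V ∘ V'⊆V H ; E'⊆E = ⊆E ∘ E'⊆E H ; L'⊆L = ⊆L ∘ L'⊆L H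
    ; E'-ends = E'-ends H ; L'-at = L'-at H }

  FreeAction-deleteVertices : ∀ {n σV σL} → FreeAction n G σV σL → FreeAction n G′ σV σL
  FreeAction-deleteVertices free = record
    { freeV = λ k 0<k k<n u u∈ → freeV k 0<k k<n u (⊆V u∈)
    ; freeE = λ k 0<k k<n e e∈ → freeE k 0<k k<n e (⊆E e∈)
    ; freeL = λ k 0<k k<n l l∈ → freeL k 0<k k<n l (⊆L l∈)
    }
    where open FreeAction free

  Adj-deleteVertices : ∀ {u w} → ¬ T (del u) → ¬ T (del w) → Adj G′ u w ⇔ Adj G u w
  Adj-deleteVertices {u} {w} ¬del-u ¬del-w = mk⇔
    (λ (e , e∈ , same) → e , ⊆E e∈ , same)
    (λ (e , e∈ , same) → e , Equivalence.from ∈E-deleteVertices (e∈ , ends-kept same) , same)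
    where
    Kept : Fin (N G) → Set
    Kept x = ¬ T (del x)
    ends-kept : ∀ {e} → SamePair (ends G e) (u , w) → Kept (proj₁ (ends G e)) × Kept (proj₂ (ends G e))
    ends-kept (inj₁ (p , q)) = subst Kept (sym p) ¬del-u , subst Kept (sym q) ¬del-w
    ends-kept (inj₂ (p , q)) = subst Kept (sym p) ¬del-w , subst Kept (sym q) ¬del-u

  CnSymmetric-deleteVertices : ∀ {n σV σL} → CnSymmetric n G σV σL →
    (∀ u → T (del (σV ⟨$⟩ʳ u)) ⇔ T (del u)) → CnSymmetric n G′ σV σL
  CnSymmetric-deleteVertices {n} {σV} {σL} symmetric invariant = record
    { aut    = record
      { pres-V   = λ u → ⇔-sym ∈V-deleteVertices ⇔-∘ ((pres-V u ×-⇔ ¬-cong-⇔ (⇔-sym (invariant u))) ⇔-∘ ∈V-deleteVertices)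
      ; pres-L   = pres-L′
      ; pres-adj = pres-adj′
      ; pres-inc = λ l l∈ → pres-inc l (⊆L l∈)
      }
    ; orderV = λ u u∈ → orderV u (⊆V u∈)
    ; orderL = λ l l∈ → orderL l (⊆L l∈)
    }
    where
    open CnSymmetric symmetric
    open IsAut aut
    pres-L′ : ∀ l → (l ∈ L G′) ⇔ (σL ⟨$⟩ʳ l ∈ L G′)
    pres-L′ l = mk⇔ to from
      where
      to : l ∈ L G′ → σL ⟨$⟩ʳ l ∈ L G′
      to l∈ = let (l∈L , ¬del) = Equivalence.to ∈L-deleteVertices l∈ in
        Equivalence.from ∈L-deleteVertices
          (Equivalence.to (pres-L l) l∈L ,
           subst (λ x → ¬ T (del x)) (sym (pres-inc l l∈L)) (¬del ∘ Equivalence.to (invariant (loopAt G l))))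
      from : σL ⟨$⟩ʳ l ∈ L G′ → l ∈ L G′
      from σl∈ = let (σl∈L , ¬del) = Equivalence.to ∈L-deleteVertices σl∈
                     l∈L = Equivalence.from (pres-L l) σl∈L in
        Equivalence.from ∈L-deleteVertices
          (l∈L , ¬del ∘ subst (T ∘ del) (sym (pres-inc l l∈L)) ∘ Equivalence.from (invariant (loopAt G l)))
    pres-adj′ : ∀ u w → u ∈ V G′ → w ∈ V G′ → Adj G′ u w ⇔ Adj G′ (σV ⟨$⟩ʳ u) (σV ⟨$⟩ʳ w)
    pres-adj′ u w u∈ w∈ =
      let (u∈V , ¬del-u) = Equivalence.to ∈V-deleteVertices u∈
          (w∈V , ¬del-w) = Equivalence.to ∈V-deleteVertices w∈
      in ⇔-sym (Adj-deleteVertices (¬del-u ∘ Equivalence.to (invariant u)) (¬del-w ∘ Equivalence.to (invariant w)))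
         ⇔-∘ (pres-adj u w u∈V w∈V ⇔-∘ Adj-deleteVertices ¬del-u ¬del-w)

  CnTight-deleteVertices : ∀ {n σV σL} → CnTight n G σV σL →
    (∀ u → T (del (σV ⟨$⟩ʳ u)) ⇔ T (del u)) →
    2 * ∣ V G′ ∣ ≤ ∣ E G′ ∣ + ∣ L G′ ∣ → CnTight n G′ σV σL
  CnTight-deleteVertices ((wf , sparse , _) , symmetric , free) invariant 2∣V′∣≤∣E′∣+∣L′∣ =
    (wf′ , sparse′ , ≤-antisym (∣E∣+∣L∣≤2∣V∣ wf′ sparse′) 2∣V′∣≤∣E′∣+∣L′∣) ,
    CnSymmetric-deleteVertices symmetric invariant ,
    FreeAction-deleteVertices free
    where
    wf′ : WellFormed G′
    wf′ = WellFormed-deleteVertices wf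
    sparse′ : Sparse G′
    sparse′ = Sparse-deleteVertices sparse

SamePair-sym : ∀ {m} {p q : Fin m × Fin m} → SamePair p q → SamePair q p
SamePair-sym (inj₁ (refl , refl)) = inj₁ (refl , refl)
SamePair-sym (inj₂ (refl , refl)) = inj₂ (refl , refl)

SamePair-trans : ∀ {m} {p q r : Fin m × Fin m} → SamePair p q → SamePair q r → SamePair p r
SamePair-trans (inj₁ (refl , refl)) same = same
SamePair-trans (inj₂ (refl , refl)) (inj₁ (refl , refl)) = inj₂ (refl , refl)
SamePair-trans (inj₂ (refl , refl)) (inj₂ (refl , refl)) = inj₁ (refl , refl)

SamePair-injective : ∀ {m} {f : Fin m → Fin m} → Injective _≡_ _≡_ f → ∀ {a b c d} →
  SamePair (f a , f b) (f c , f d) → SamePair (a , b) (c , d)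
SamePair-injective f-inj (inj₁ (p , q)) = inj₁ (f-inj p , f-inj q)
SamePair-injective f-inj (inj₂ (p , q)) = inj₂ (f-inj p , f-inj q)

SamePair-incident : ∀ {m} {a b c d z : Fin m} → SamePair (a , b) (c , d) → c ≡ z ⊎ d ≡ z → a ≡ z ⊎ b ≡ z
SamePair-incident (inj₁ (refl , refl)) inc = inc
SamePair-incident (inj₂ (refl , refl)) inc = Sum.swap inc

degree : (G : LGraph) → Fin (N G) → ℕ
degree G u = ∣ incEdges G u ∣ + ∣ incLoops G u ∣

module _ {G σV σL} (wf : WellFormed G) (aut : IsAut G σV σL) where

  open WellFormed wf
  open IsAut aut

  private
    s : Fin (N G) → Fin (N G)
    s = σV ⟨$⟩ʳ_
    t : Fin (K G) → Fin (K G)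
    t = σL ⟨$⟩ʳ_

  degree-≤-image : ∀ u → degree G u ≤ degree G (s u)
  degree-≤-image u = +-mono-≤ edges loops
    where
    Image : Fin (M G) → Fin (M G) → Set
    Image e f = f ∈ E G × SamePair (ends G f) (s (proj₁ (ends G e)) , s (proj₂ (ends G e)))
    edges : ∣ incEdges G u ∣ ≤ ∣ incEdges G (s u) ∣
    edges = ∣p∣≤∣q∣-injective Image image injective
      where
      image : ∀ {e} → e ∈ incEdges G u → ∃ λ f → f ∈ incEdges G (s u) × Image e f
      image e∈ with Equivalence.to (∈-incEdges G) e∈
      ... | e∈E , at-u with Equivalence.to (pres-adj _ _ (proj₁ (ends-in _ e∈E)) (proj₂ (ends-in _ e∈E))) (_ , e∈E , inj₁ (refl , refl))
      ...   | f , f∈E , same =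
        f , Equivalence.from (∈-incEdges G) (f∈E , SamePair-incident same (Sum.map (cong s) (cong s) at-u)) , f∈E , same
      injective : ∀ {e e′ f} → e ∈ incEdges G u → e′ ∈ incEdges G u → Image e f → Image e′ f → e ≡ e′
      injective e∈ e′∈ (_ , same) (_ , same′) =
        simple _ _ (proj₁ (Equivalence.to (∈-incEdges G) e∈)) (proj₁ (Equivalence.to (∈-incEdges G) e′∈))
          (SamePair-injective (Injection.injective (↔⇒↣ σV)) (SamePair-trans (SamePair-sym same) same′))
    loops : ∣ incLoops G u ∣ ≤ ∣ incLoops G (s u) ∣
    loops = ∣p∣≤∣q∣-injective (λ l l′ → t l ≡ l′) image
      (λ _ _ p p′ → Injection.injective (↔⇒↣ σL) (trans p (sym p′)))
      where
      image : ∀ {l} → l ∈ incLoops G u → ∃ λ l′ → l′ ∈ incLoops G (s u) × t l ≡ l′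
      image l∈ with Equivalence.to (∈-incLoops G) l∈
      ... | l∈L , refl = t _ , Equivalence.from (∈-incLoops G) (Equivalence.to (pres-L _) l∈L , pres-inc _ l∈L) , refl

module _ {n G σV σL} (tight : CnTight n G σV σL) (v : Fin (N G)) (v∈V : v ∈ V G) where

  private
    wf : WellFormed G
    wf = proj₁ (proj₁ tight)
    symmetric : CnSymmetric n G σV σL
    symmetric = proj₁ (proj₂ tight)
    free : FreeAction n G σV σL
    free = proj₂ (proj₂ tight)
    open CnSymmetric symmetric
    open IsAut aut
    s : Fin (N G) → Fin (N G)
    s = σV ⟨$⟩ʳ_
    G′ : LGraph
    G′ = deleteOrbit n G σV v

  orbit : ℕ → Fin (N G)
  orbit j = iter s j v

  inOrbit? : Fin (N G) → Bool
  inOrbit? = inOrbit s n (λ a b → ⌊ a ≟ b ⌋) v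

  orbit∈V : ∀ j → orbit j ∈ V G
  orbit∈V zero    = v∈V
  orbit∈V (suc j) = Equivalence.to (pres-V (orbit j)) (orbit∈V j)

  orbit-distinct : ∀ {i j} → i < j → j < n → orbit i ≢ orbit j
  orbit-distinct {i} {j} i<j j<n eq =
    FreeAction.freeV free (j ∸ i) (m<n⇒0<n∸m i<j) (≤-<-trans (m∸n≤m j i) j<n) (orbit i) (orbit∈V i)
      (begin
        iter s (j ∸ i) (orbit i) ≡⟨ iter-+ s (j ∸ i) i v ⟨
        orbit (j ∸ i + i)        ≡⟨ cong orbit (m∸n+n≡m (<⇒≤ i<j)) ⟩
        orbit j                  ≡⟨ eq ⟨
        orbit i                  ∎)
    where open ≡-Reasoning

  inOrbit?-invariant : ∀ u → T (inOrbit? (s u)) ⇔ T (inOrbit? u)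
  inOrbit?-invariant u =
    ⇔-sym (T-inOrbit s _≟_ n v u) ⇔-∘
    (InOrbit-step s (Injection.injective (↔⇒↣ σV)) (orderV v v∈V) u ⇔-∘ T-inOrbit s _≟_ n v (s u))

  degree-orbit : ∀ {j} → j < n → degree G (orbit j) ≤ degree G v
  degree-orbit j<n = iter-cycle-≤ s (degree G) (degree-≤-image wf aut) (orderV v v∈V) (<⇒≤ j<n)

  ∣V′∣+n≤∣V∣ : ∣ V G′ ∣ + n ≤ ∣ V G ∣
  ∣V′∣+n≤∣V∣ = ∣p∣+k≤∣q∣ orbit n (proj₁ ∘ Equivalence.to (∈V-deleteVertices G inOrbit?)) (λ {j} _ → orbit∈V j)
    (λ {j} j<n u∈ → proj₂ (Equivalence.to (∈V-deleteVertices G inOrbit?) u∈)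
                      (Equivalence.from (T-inOrbit s _≟_ n v (orbit j)) (j , j<n , refl)))
    orbit-distinct

  orbitEdges : Subset (M G)
  orbitEdges = ⋃< n (incEdges G ∘ orbit)

  orbitLoops : Subset (K G)
  orbitLoops = ⋃< n (incLoops G ∘ orbit)

  ∈orbitEdges : ∀ {e a} → e ∈ E G → T (inOrbit? a) → proj₁ (ends G e) ≡ a ⊎ proj₂ (ends G e) ≡ a → e ∈ orbitEdges
  ∈orbitEdges e∈E a∈ at-a with Equivalence.to (T-inOrbit s _≟_ n v _) a∈
  ... | j , j<n , refl = ∈⋃< j<n (Equivalence.from (∈-incEdges G) (e∈E , at-a))

  E⊆E′∪orbitEdges : E G ⊆ E G′ ∪ orbitEdges
  E⊆E′∪orbitEdges {e} e∈E with T? (inOrbit? (proj₁ (ends G e))) | T? (inOrbit? (proj₂ (ends G e)))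
  ... | yes a∈   | _        = x∈p∪q⁺ (inj₂ (∈orbitEdges e∈E a∈ (inj₁ refl)))
  ... | no _     | yes b∈   = x∈p∪q⁺ (inj₂ (∈orbitEdges e∈E b∈ (inj₂ refl)))
  ... | no a∉    | no b∉    = x∈p∪q⁺ (inj₁ (Equivalence.from (∈E-deleteVertices G inOrbit?) (e∈E , a∉ , b∉)))

  L⊆L′∪orbitLoops : L G ⊆ L G′ ∪ orbitLoops
  L⊆L′∪orbitLoops {l} l∈L with T? (inOrbit? (loopAt G l))
  ... | no a∉ = x∈p∪q⁺ (inj₁ (Equivalence.from (∈L-deleteVertices G inOrbit?) (l∈L , a∉)))
  ... | yes a∈ with Equivalence.to (T-inOrbit s _≟_ n v _) a∈
  ...   | j , j<n , eq = x∈p∪q⁺ (inj₂ (∈⋃< j<n (Equivalence.from (∈-incLoops G) (l∈L , sym eq))))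

  2∣V′∣≤∣E′∣+∣L′∣ : degree G v ≤ 2 → 2 * ∣ V G′ ∣ ≤ ∣ E G′ ∣ + ∣ L G′ ∣
  2∣V′∣≤∣E′∣+∣L′∣ deg-v≤2 = +-cancelʳ-≤ (n * 2) _ _ (begin
    2 * ∣ V G′ ∣ + n * 2                                  ≡⟨ cong (2 * ∣ V G′ ∣ +_) (*-comm n 2) ⟩
    2 * ∣ V G′ ∣ + 2 * n                                  ≡⟨ *-distribˡ-+ 2 ∣ V G′ ∣ n ⟨
    2 * (∣ V G′ ∣ + n)                                    ≤⟨ *-monoʳ-≤ 2 ∣V′∣+n≤∣V∣ ⟩
    2 * ∣ V G ∣                                           ≡⟨ proj₂ (proj₂ (proj₁ tight)) ⟨
    ∣ E G ∣ + ∣ L G ∣                                     ≤⟨ +-mono-≤ (p⊆q⇒∣p∣≤∣q∣ E⊆E′∪orbitEdges) (p⊆q⇒∣p∣≤∣q∣ L⊆L′∪orbitLoops) ⟩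
    ∣ E G′ ∪ orbitEdges ∣ + ∣ L G′ ∪ orbitLoops ∣          ≤⟨ +-mono-≤ (∣p∪q∣≤∣p∣+∣q∣ (E G′) orbitEdges) (∣p∪q∣≤∣p∣+∣q∣ (L G′) orbitLoops) ⟩
    (∣ E G′ ∣ + ∣ orbitEdges ∣) + (∣ L G′ ∣ + ∣ orbitLoops ∣) ≡⟨ interchange (∣ E G′ ∣) (∣ orbitEdges ∣) (∣ L G′ ∣) (∣ orbitLoops ∣) ⟩
    (∣ E G′ ∣ + ∣ L G′ ∣) + (∣ orbitEdges ∣ + ∣ orbitLoops ∣) ≤⟨ +-monoʳ-≤ (∣ E G′ ∣ + ∣ L G′ ∣) orbit-bound ⟩
    (∣ E G′ ∣ + ∣ L G′ ∣) + n * 2                          ∎)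
    where
    open ≤-Reasoning
    orbit-bound : ∣ orbitEdges ∣ + ∣ orbitLoops ∣ ≤ n * 2
    orbit-bound = ∣⋃<∣+∣⋃<∣≤ n (incEdges G ∘ orbit) (incLoops G ∘ orbit) 2 (λ j<n → ≤-trans (degree-orbit j<n) deg-v≤2)

  -- deleteOrbit n G σV v unfolds to deleteVertices G inOrbit?.
  CnTight-deleteOrbit : degree G v ≤ 2 → CnTight n G′ σV σL
  CnTight-deleteOrbit deg-v≤2 = CnTight-deleteVertices G inOrbit? tight inOrbit?-invariant (2∣V′∣≤∣E′∣+∣L′∣ deg-v≤2)

lemma6p1 : (n : ℕ) → 3 ≤ n → n % 2 ≡ 1 →
    (G : LGraph) (σV : Permutation′ (N G)) (σL : Permutation′ (K G)) →
    CnTight n G σV σL →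
    (v : Fin (N G)) → v ∈ V G →
    ((∣ incEdges G v ∣ ≡ 2 × ∣ incLoops G v ∣ ≡ 0) ⊎ (∣ incEdges G v ∣ ≡ 1 × ∣ incLoops G v ∣ ≡ 1)) →
    CnTight n (deleteOrbit n G σV v) σV σL
lemma6p1 n _ _ G σV σL tight v v∈V deg = CnTight-deleteOrbit tight v v∈V (≤-reflexive (degree≡2 deg))
  where
  degree≡2 : ((∣ incEdges G v ∣ ≡ 2 × ∣ incLoops G v ∣ ≡ 0) ⊎ (∣ incEdges G v ∣ ≡ 1 × ∣ incLoops G v ∣ ≡ 1)) → degree G v ≡ 2
  degree≡2 (inj₁ (e , l)) = cong₂ _+_ e l
  degree≡2 (inj₂ (e , l)) = cong₂ _+_ e l
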